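{- Let $n$ be an even positive integer and let $\xi=a_1\cdots a_i a_{i+1}\cdots a_{n-1}n$ be a permutation of $[n]$ with last entry $n$ which is not parity alternating, such that $a_{i+1}\cdots a_{n-1}n$ is a maximal PAP sequence of $\xi$, and such that $a_1$ is even. Write $\tau^{n-i}\xi=c_1\cdots c_{n-i}c_{n-i+1}\cdots c_{n-1}n$. Then $c_1\cdots c_{n-i}$ is a maximal PAP sequence of $\tau^{n-i}\xi$.
   Context: Permutations of $[n]=\{1,\dots,n\}$ are written in one-line notation. A permutation $a_1\cdots a_n$ is parity alternating if $a_j,a_{j+1}$ have different parities for all $1\le j\le n-1$. A PAP sequence of $a_1\cdots a_n$ is a consecutive block $a_{r+1}\cdots a_s$ in which consecutive entries have different parities; it is maximal if it cannot be extended by an adjacent entry on either side (where such an entry exists) to a longer PAP sequence. The operator $\sigma$ on permutations of $[n]$: (a) if $n$ is neither $a_1$ nor $a_n$, $\sigma(a_1\cdots a_n)=b_1\cdots b_n$ with $b_j=a_j+1$, except that the entry $n+1$ is replaced by $1$ in its position; (b) if $a_n=n$, $\sigma(a_1\cdots a_{n-1}n)=1\,b_1\cdots b_{n-1}$ with $b_j=a_j+1$; (c) if $a_1=n$, $\sigma(na_1\cdots a_{n-1})=b_1\cdots b_{n-1}\,1$ with $b_j=a_j+1$. For $\xi=a_1\cdots a_{n-1}n$ (last entry $n$), $\tau\xi=\sigma^{\,n-a_{n-1}}\xi$, the $(n-a_{n-1})$-fold application of $\sigma$; $\tau\xi$ again has last entry $n$, and $\tau^\ell$ denotes $\ell$-fold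 application of $\tau$. -}

module Defs where

open import Data.Nat.Base using (ℕ; zero; suc; _∸_; _%_; _≡ᵇ_; _<_)
open import Data.Bool.Base using (if_then_else_)
open import Data.List.Base using (List; []; _∷_; map; _++_; [_]; upTo; take; drop; reverse; length)
open import Data.Maybe.Base using (Maybe; just; nothing)
open import Data.Product.Base using (_×_)
open import Relation.Binary.PropositionalEquality using (_≡_; _≢_)
open import Relation.Nullary using (¬_)
open import Data.List.Relation.Binary.Permutation.Propositional using (_↭_)

[_]ₙ : ℕ → List ℕ
[ n ]ₙ = map suc (upTo n)

IsPerm : ℕ → List ℕ → Set
IsPerm n xs = xs ↭ [ n ]ₙ

Alternating : List ℕ → Set
Alternating []           = Data.Unit.⊤ where import Data.Unit
Alternating (x ∷ [])     = Data.Unit.⊤ where import Data.Unit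
Alternating (x ∷ y ∷ zs) = (x % 2 ≢ y % 2) × Alternating (y ∷ zs)

-- the consecutive block a_{r+1} ⋯ a_s  (entries are 1-indexed as in the paper)
Block : ℕ → ℕ → List ℕ → List ℕ
Block r s xs = drop r (take s xs)

IsPAP : List ℕ → ℕ → ℕ → Set
IsPAP xs r s = (r < s) × (s Data.Nat.Base.≤ length xs) × Alternating (Block r s xs)

IsMaximalPAP : List ℕ → ℕ → ℕ → Set
IsMaximalPAP xs r s =
  IsPAP xs r s
  × (0 < r → ¬ IsPAP xs (r ∸ 1) s)
  × (s < length xs → ¬ IsPAP xs r (suc s))

incr : ℕ → ℕ → ℕ
incr n a = if a ≡ᵇ n then 1 else suc a

lastOr : ℕ → List ℕ → ℕ
lastOr d []       = d
lastOr d (x ∷ xs) = lastOr x xs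

initL : List ℕ → List ℕ
initL []           = []
initL (x ∷ [])     = []
initL (x ∷ y ∷ xs) = x ∷ initL (y ∷ xs)

σ : ℕ → List ℕ → List ℕ
σ n []       = []
σ n (x ∷ xs) =
  if lastOr x xs ≡ᵇ n then 1 ∷ map suc (initL (x ∷ xs))
  else (if x ≡ᵇ n then map suc xs ++ [ 1 ]
  else map (incr n) (x ∷ xs))

_^[_] : {A : Set} → (A → A) → ℕ → A → A
(f ^[ zero ]) x  = x
(f ^[ suc k ]) x = f ((f ^[ k ]) x)

secondLast : List ℕ → ℕ
secondLast xs = lastOr 0 (initL xs)

τ : ℕ → List ℕ → List ℕ
τ n ξ = (σ n ^[ n ∸ secondLast ξ ]) ξ

-- One application of τ moves the final n to the front and then increases every entry
-- cyclically modulo n by n − a_{n−1}, giving again a permutation ending in n. For even n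
-- the cyclic increment x ↦ x + 1 (n ↦ 1) flips the parity of every entry, so τ^k ξ is the
-- k-fold rotation of ξ up to a relabelling that preserves which entries have equal parity.
-- With k = n − i and ξ = A B, B = a_{i+1} ⋯ n, this is B A up to such a relabelling: the
-- alternating block B becomes the prefix c_1 ⋯ c_{n−i}, and it cannot be extended because
-- its last entry n and the following entry a_1 are both even.

module Submission where

open import Defs
open import Data.Nat.Base using (ℕ; _<_; _≤_; _∸_)
open import Data.Nat.Divisibility using (_∣_)
open import Data.List.Base using (List; _∷_; _++_; [_])
open import Data.Product.Base using (_×_)
open import Relation.Binary.PropositionalEquality using (_≡_)
open import Relation.Nullary using (¬_)

open import Data.Nat.Base using (zero; suc; _+_; _%_; _≡ᵇ_; parity; s≤s; z≤n; s<s⁻¹)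
open import Data.Nat.Properties
open import Data.Nat.Divisibility using (divides)
open import Data.Parity.Base as ℙ using (Parity; 0ℙ; 1ℙ)
open import Data.Parity.Properties as ℙ using (+-homo-+; *-homo-*)
open import Data.Bool.Base using (true; false)
open import Data.Empty using (⊥-elim)
open import Data.List.Base using ([]; map; take; drop; length; upTo)
open import Data.List.Properties
  using (map-++; map-∘; map-id; map-cong-local; length-map; length-drop; take-map; drop-map;
         take-all; take++drop≡id; ++-identityʳ; ++-assoc; upTo-∷ʳ; map-upTo; length-++-≤ˡ; length-upTo)
open import Data.List.Relation.Unary.All as All using (All; []; _∷_)
open import Data.List.Relation.Unary.All.Properties as All using (map⁺; applyUpTo⁺₁; ∷ʳ⁻)
open import Data.List.Relation.Binary.Permutation.Propositional
  using (_↭_; ↭-sym; ↭-trans; ↭-reflexive; module PermutationReasoning)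
open import Data.List.Relation.Binary.Permutation.Propositional.Properties as Perm
  using (All-resp-↭; ↭-length; drop-mid; ∷↭∷ʳ; ¬x∷xs↭[])
open import Data.Product.Base using (∃; ∃₂; _,_; proj₁; proj₂)
open import Function.Base using (id; _∘_)
open import Function.Bundles using (_⇔_; mk⇔; Equivalence)
open import Relation.Binary.PropositionalEquality
  using (refl; sym; trans; cong; cong₂; subst; subst₂; _≢_; module ≡-Reasoning)
open import Relation.Nullary using (yes; no)

open Equivalence using (to; from)

residue : Parity → ℕ
residue 0ℙ = 0
residue 1ℙ = 1

residue-injective : ∀ {p q} → residue p ≡ residue q → p ≡ q
residue-injective {0ℙ} {0ℙ} _ = refl
residue-injective {1ℙ} {1ℙ} _ = refl
residue-injective {0ℙ} {1ℙ} ()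
residue-injective {1ℙ} {0ℙ} ()

%2≡residue∘parity : ∀ x → x % 2 ≡ residue (parity x)
%2≡residue∘parity zero = refl
%2≡residue∘parity (suc zero) = refl
%2≡residue∘parity (suc (suc x)) = %2≡residue∘parity x

%2-≡⇔parity-≡ : ∀ x y → x % 2 ≡ y % 2 ⇔ parity x ≡ parity y
%2-≡⇔parity-≡ x y = mk⇔
  (λ eq → residue-injective (trans (sym (%2≡residue∘parity x)) (trans eq (%2≡residue∘parity y))))
  (λ eq → trans (%2≡residue∘parity x) (trans (cong residue eq) (sym (%2≡residue∘parity y))))

parity-even : ∀ {n} → 2 ∣ n → parity n ≡ 0ℙ
parity-even (divides q refl) = trans (*-homo-* q 2) (ℙ.*-zeroʳ (parity q))

record ShiftsParity (f : ℕ → ℕ) : Set where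
  constructor shiftsBy
  field
    shift    : Parity
    parity-f : ∀ x → parity (f x) ≡ shift ℙ.+ parity x

ShiftsParity-id : ShiftsParity id
ShiftsParity-id = shiftsBy 0ℙ λ _ → refl

ShiftsParity-∘ : ∀ {f g} → ShiftsParity f → ShiftsParity g → ShiftsParity (f ∘ g)
ShiftsParity-∘ {f} {g} (shiftsBy p fp) (shiftsBy q gq) = shiftsBy (p ℙ.+ q) λ x → begin
  parity (f (g x))          ≡⟨ fp (g x) ⟩
  p ℙ.+ parity (g x)        ≡⟨ cong (p ℙ.+_) (gq x) ⟩
  p ℙ.+ (q ℙ.+ parity x)    ≡⟨ ℙ.+-assoc p q (parity x) ⟨
  p ℙ.+ q ℙ.+ parity x      ∎
  where open ≡-Reasoning

ShiftsParity-^ : ∀ {f} → ShiftsParity f → ∀ k → ShiftsParity (f ^[ k ])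
ShiftsParity-^ sh zero = ShiftsParity-id
ShiftsParity-^ sh (suc k) = ShiftsParity-∘ sh (ShiftsParity-^ sh k)

ShiftsParity-sameParity : ∀ {f} → ShiftsParity f → ∀ x y → f x % 2 ≡ f y % 2 ⇔ x % 2 ≡ y % 2
ShiftsParity-sameParity {f} (shiftsBy p fp) x y = mk⇔
  (λ eq → from (%2-≡⇔parity-≡ x y)
            (ℙ.+-cancelˡ-≡ p _ _ (trans (sym (fp x)) (trans (to (%2-≡⇔parity-≡ (f x) (f y)) eq) (fp y)))))
  (λ eq → from (%2-≡⇔parity-≡ (f x) (f y))
            (trans (fp x) (trans (cong (p ℙ.+_) (to (%2-≡⇔parity-≡ x y) eq)) (sym (fp y)))))

take-length-++ : ∀ (xs ys : List ℕ) → take (length xs) (xs ++ ys) ≡ xs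
take-length-++ []       ys = refl
take-length-++ (x ∷ xs) ys = cong (x ∷_) (take-length-++ xs ys)

take-suc-length-++ : ∀ (xs : List ℕ) y ys → take (suc (length xs)) (xs ++ y ∷ ys) ≡ xs ++ [ y ]
take-suc-length-++ []       y ys = refl
take-suc-length-++ (x ∷ xs) y ys = cong (x ∷_) (take-suc-length-++ xs y ys)

drop-∷ʳ : ∀ i (xs : List ℕ) x → i < length (xs ++ [ x ]) → drop i (xs ++ [ x ]) ≡ drop i xs ++ [ x ]
drop-∷ʳ zero    xs       x _         = refl
drop-∷ʳ (suc i) []       x (s≤s ())
drop-∷ʳ (suc i) (y ∷ ys) x (s≤s i<n) = drop-∷ʳ i ys x i<n

Alternating-map : ∀ {f} → ShiftsParity f → ∀ xs → Alternating (map f xs) ⇔ Alternating xs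
Alternating-map sh []           = mk⇔ id id
Alternating-map sh (x ∷ [])     = mk⇔ id id
Alternating-map sh (x ∷ y ∷ zs) = mk⇔
  (λ (d , alt) → d ∘ from (ShiftsParity-sameParity sh x y) , to (Alternating-map sh (y ∷ zs)) alt)
  (λ (d , alt) → d ∘ to (ShiftsParity-sameParity sh x y) , from (Alternating-map sh (y ∷ zs)) alt)

Alternating-∷ʳ-∷ʳ⁻ : ∀ xs x y → Alternating ((xs ++ [ x ]) ++ [ y ]) → x % 2 ≢ y % 2
Alternating-∷ʳ-∷ʳ⁻ []           x y (d , _)   = d
Alternating-∷ʳ-∷ʳ⁻ (_ ∷ [])     x y (_ , alt) = Alternating-∷ʳ-∷ʳ⁻ [] x y alt
Alternating-∷ʳ-∷ʳ⁻ (_ ∷ w ∷ ws) x y (_ , alt) = Alternating-∷ʳ-∷ʳ⁻ (w ∷ ws) x y alt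

Block-map : ∀ (f : ℕ → ℕ) r s xs → Block r s (map f xs) ≡ map f (Block r s xs)
Block-map f r s xs = trans (cong (drop r) (take-map s xs)) (drop-map r (take s xs))

IsPAP-map : ∀ {f} → ShiftsParity f → ∀ xs r s → IsPAP (map f xs) r s ⇔ IsPAP xs r s
IsPAP-map {f} sh xs r s = mk⇔
  (λ (r<s , s≤ , alt) → r<s , subst (s ≤_) (length-map f xs) s≤ ,
                         to (Alternating-map sh (Block r s xs)) (subst Alternating (Block-map f r s xs) alt))
  (λ (r<s , s≤ , alt) → r<s , subst (s ≤_) (sym (length-map f xs)) s≤ ,
                         subst Alternating (sym (Block-map f r s xs)) (from (Alternating-map sh (Block r s xs)) alt))

IsMaximalPAP-map : ∀ {f} → ShiftsParity f → ∀ {xs r s} → IsMaximalPAP xs r s → IsMaximalPAP (map f xs) r s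
IsMaximalPAP-map {f} sh {xs} {r} {s} (pap , ¬left , ¬right) =
  from (IsPAP-map sh xs r s) pap ,
  (λ 0<r → ¬left 0<r ∘ to (IsPAP-map sh xs (r ∸ 1) s)) ,
  (λ s<len → ¬right (subst (s <_) (length-map f xs) s<len) ∘ to (IsPAP-map sh xs r (suc s)))

IsMaximalPAP-prefix : ∀ xs {x y} ys → Alternating (xs ++ [ x ]) → x % 2 ≡ y % 2 →
                      IsMaximalPAP ((xs ++ [ x ]) ++ y ∷ ys) 0 (length (xs ++ [ x ]))
IsMaximalPAP-prefix xs {x} {y} ys alt x≡y =
  (nonempty xs , length-++-≤ˡ (xs ++ [ x ]) , subst Alternating (sym (take-length-++ (xs ++ [ x ]) (y ∷ ys))) alt) ,
  (λ ()) ,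
  (λ _ (_ , _ , alt′) → Alternating-∷ʳ-∷ʳ⁻ xs x y (subst Alternating (take-suc-length-++ (xs ++ [ x ]) y ys) alt′) x≡y)
  where
  nonempty : ∀ zs → 0 < length (zs ++ [ x ])
  nonempty []      = s≤s z≤n
  nonempty (_ ∷ _) = s≤s z≤n

lastOr-∷ʳ : ∀ x ys z → lastOr x (ys ++ [ z ]) ≡ z
lastOr-∷ʳ x []       z = refl
lastOr-∷ʳ x (y ∷ ys) z = lastOr-∷ʳ y ys z

initL-∷ʳ : ∀ ys z → initL (ys ++ [ z ]) ≡ ys
initL-∷ʳ []           z = refl
initL-∷ʳ (y ∷ [])     z = refl
initL-∷ʳ (y ∷ w ∷ ws) z = cong (y ∷_) (initL-∷ʳ (w ∷ ws) z)

initL-++-lastOr : ∀ x xs → x ∷ xs ≡ initL (x ∷ xs) ++ [ lastOr x xs ]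
initL-++-lastOr x []       = refl
initL-++-lastOr x (y ∷ ys) = cong (x ∷_) (initL-++-lastOr y ys)

lastOr-map : ∀ (f : ℕ → ℕ) x xs → lastOr (f x) (map f xs) ≡ f (lastOr x xs)
lastOr-map f x []       = refl
lastOr-map f x (y ∷ ys) = lastOr-map f y ys

initL-map : ∀ (f : ℕ → ℕ) xs → initL (map f xs) ≡ map f (initL xs)
initL-map f []           = refl
initL-map f (x ∷ [])     = refl
initL-map f (x ∷ y ∷ ys) = cong (f x ∷_) (initL-map f (y ∷ ys))

rotateʳ : List ℕ → List ℕ
rotateʳ []       = []
rotateʳ (x ∷ xs) = lastOr x xs ∷ initL (x ∷ xs)

rotateʳ-∷ʳ : ∀ ys z → rotateʳ (ys ++ [ z ]) ≡ z ∷ ys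
rotateʳ-∷ʳ []       z = refl
rotateʳ-∷ʳ (y ∷ ys) z = cong₂ _∷_ (lastOr-∷ʳ y ys z) (initL-∷ʳ (y ∷ ys) z)

rotateʳ-map : ∀ f xs → rotateʳ (map f xs) ≡ map f (rotateʳ xs)
rotateʳ-map f []       = refl
rotateʳ-map f (x ∷ xs) = cong₂ _∷_ (lastOr-map f x xs) (initL-map f (x ∷ xs))

rotateʳ^-++ : ∀ k us vs → length vs ≡ k → (rotateʳ ^[ k ]) (us ++ vs) ≡ vs ++ us
rotateʳ^-++ zero    us []       refl = ++-identityʳ us
rotateʳ^-++ (suc k) us (v ∷ vs) eq = begin
  rotateʳ ((rotateʳ ^[ k ]) (us ++ v ∷ vs))     ≡⟨ cong (rotateʳ ∘ (rotateʳ ^[ k ])) (++-assoc us [ v ] vs) ⟨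
  rotateʳ ((rotateʳ ^[ k ]) ((us ++ [ v ]) ++ vs)) ≡⟨ cong rotateʳ (rotateʳ^-++ k (us ++ [ v ]) vs (suc-injective eq)) ⟩
  rotateʳ (vs ++ us ++ [ v ])                    ≡⟨ cong rotateʳ (++-assoc vs us [ v ]) ⟨
  rotateʳ ((vs ++ us) ++ [ v ])                  ≡⟨ rotateʳ-∷ʳ (vs ++ us) v ⟩
  v ∷ vs ++ us                                   ∎
  where open ≡-Reasoning

≡ᵇ-refl : ∀ n → (n ≡ᵇ n) ≡ true
≡ᵇ-refl n with n ≡ᵇ n | ≡⇒≡ᵇ n n refl
... | true | _ = refl

≢⇒≡ᵇ-false : ∀ {m n} → m ≢ n → (m ≡ᵇ n) ≡ false
≢⇒≡ᵇ-false {m} {n} m≢n with m ≡ᵇ n | ≡ᵇ⇒≡ m n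
... | false | _  = refl
... | true  | eq = ⊥-elim (m≢n (eq _))

incr-self : ∀ n → incr n n ≡ 1
incr-self n rewrite ≡ᵇ-refl n = refl

incr-≢ : ∀ {n x} → x ≢ n → incr n x ≡ suc x
incr-≢ x≢n rewrite ≢⇒≡ᵇ-false x≢n = refl

parity-incr : ∀ {n} → parity n ≡ 0ℙ → ∀ x → parity (incr n x) ≡ 1ℙ ℙ.+ parity x
parity-incr {n} even x with x ≟ n
... | yes refl rewrite incr-self x | even = refl
... | no x≢n   rewrite incr-≢ x≢n = +-homo-+ 1 x

incr^-+ : ∀ {n} v t → v + t ≤ n → (incr n ^[ t ]) v ≡ v + t
incr^-+ v zero    _ = sym (+-identityʳ v)
incr^-+ {n} v (suc t) le = begin
  incr n ((incr n ^[ t ]) v) ≡⟨ cong (incr n) (incr^-+ v t (≤-trans (+-monoʳ-≤ v (n≤1+n t)) le)) ⟩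
  incr n (v + t)             ≡⟨ incr-≢ (<⇒≢ (subst (_≤ n) (+-suc v t) le)) ⟩
  suc (v + t)                ≡⟨ +-suc v t ⟨
  v + suc t                  ∎
  where open ≡-Reasoning

incr^-self : ∀ {n} t → t < n → (incr n ^[ suc t ]) n ≡ suc t
incr^-self {n} zero    _  = incr-self n
incr^-self     (suc t) lt rewrite incr^-self t (<⇒≤ lt) = incr-≢ (<⇒≢ lt)

σ-∷ʳ-self : ∀ {n} ys → All (_≢ n) ys → σ n (ys ++ [ n ]) ≡ map (incr n) (n ∷ ys)
σ-∷ʳ-self {n} [] _ rewrite ≡ᵇ-refl n = refl
σ-∷ʳ-self {n} (y ∷ ys) ≢n
  rewrite lastOr-∷ʳ y ys n | ≡ᵇ-refl n | initL-∷ʳ (y ∷ ys) n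
  = cong (1 ∷_) (sym (map-cong-local (All.map incr-≢ ≢n)))

σ-≢ : ∀ {n} x xs → x ≢ n → lastOr x xs ≢ n → σ n (x ∷ xs) ≡ map (incr n) (x ∷ xs)
σ-≢ x xs x≢n last≢n rewrite ≢⇒≡ᵇ-false last≢n | ≢⇒≡ᵇ-false x≢n = refl

-- Case (b) moves n to the front; it returns to the end only after n ∸ a steps, and until
-- then σ acts by case (a).
σ^-∷ʳ-self : ∀ {n} zs a → All (_< n) (zs ++ [ a ]) → ∀ t → a + suc t ≤ n →
             (σ n ^[ suc t ]) ((zs ++ [ a ]) ++ [ n ]) ≡ map (incr n ^[ suc t ]) (n ∷ zs ++ [ a ])
σ^-∷ʳ-self zs a <n zero _ = σ-∷ʳ-self (zs ++ [ a ]) (All.map <⇒≢ <n)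
σ^-∷ʳ-self {n} zs a <n (suc t) le = begin
  σ n ((σ n ^[ suc t ]) ((zs ++ [ a ]) ++ [ n ]))
    ≡⟨ cong (σ n) (σ^-∷ʳ-self zs a <n t (≤-trans (+-monoʳ-≤ a (n≤1+n (suc t))) le)) ⟩
  σ n (map g (n ∷ zs ++ [ a ]))
    ≡⟨ σ-≢ (g n) (map g (zs ++ [ a ])) head≢n last≢n ⟩
  map (incr n) (map g (n ∷ zs ++ [ a ]))
    ≡⟨ map-∘ (n ∷ zs ++ [ a ]) ⟨
  map (incr n ^[ suc (suc t) ]) (n ∷ zs ++ [ a ]) ∎
  where
  open ≡-Reasoning
  g = incr n ^[ suc t ]
  a+t<n : a + suc t < n
  a+t<n = subst (_≤ n) (+-suc a (suc t)) le
  1+t<n : suc t < n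
  1+t<n = ≤-trans (m≤n+m (suc (suc t)) a) le
  head≢n : g n ≢ n
  head≢n rewrite incr^-self t (<⇒≤ 1+t<n) = <⇒≢ 1+t<n
  last≢n : lastOr (g n) (map g (zs ++ [ a ])) ≢ n
  last≢n rewrite map-++ g zs [ a ] | lastOr-∷ʳ (g n) (map g zs) (g a) | incr^-+ {n} a (suc t) (<⇒≤ a+t<n) =
    <⇒≢ a+t<n

[]ₙ-∷ʳ : ∀ m → [ suc m ]ₙ ≡ [ m ]ₙ ++ [ suc m ]
[]ₙ-∷ʳ m = trans (cong (map suc) (sym (upTo-∷ʳ m))) (map-++ suc (upTo m) [ m ])

[]ₙ-∷ : ∀ m → [ suc m ]ₙ ≡ 1 ∷ map suc [ m ]ₙ
[]ₙ-∷ m = cong (λ xs → 1 ∷ map suc xs) (sym (map-upTo suc m))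

All-≤-[]ₙ : ∀ n → All (_≤ n) [ n ]ₙ
All-≤-[]ₙ n = map⁺ (applyUpTo⁺₁ id n id)

IsPerm-length : ∀ {n xs} → IsPerm n xs → length xs ≡ n
IsPerm-length {n} perm = trans (↭-length perm) (trans (length-map suc (upTo n)) (length-upTo n))

IsPerm-≤ : ∀ {n xs} → IsPerm n xs → All (_≤ n) xs
IsPerm-≤ {n} perm = All-resp-↭ (↭-sym perm) (All-≤-[]ₙ n)

IsPerm-∷ʳ-< : ∀ {n} ys → IsPerm n (ys ++ [ n ]) → All (_< n) ys
IsPerm-∷ʳ-< {zero} []      perm = ⊥-elim (¬x∷xs↭[] perm)
IsPerm-∷ʳ-< {zero} (_ ∷ _) perm = ⊥-elim (¬x∷xs↭[] perm)
IsPerm-∷ʳ-< {suc m} ys     perm = All.map s≤s (IsPerm-≤ ys↭[m])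
  where
  ys↭[m] : IsPerm m ys
  ys↭[m] = subst₂ _↭_ (++-identityʳ ys) (++-identityʳ [ m ]ₙ)
             (drop-mid ys [ m ]ₙ (↭-trans perm (↭-reflexive ([]ₙ-∷ʳ m))))

incr-permutes : ∀ n → map (incr n) [ n ]ₙ ↭ [ n ]ₙ
incr-permutes zero    = ↭-reflexive refl
incr-permutes (suc m) = begin
  map (incr n) [ n ]ₙ                        ≡⟨ cong (map (incr n)) ([]ₙ-∷ʳ m) ⟩
  map (incr n) ([ m ]ₙ ++ [ n ])             ≡⟨ map-++ (incr n) [ m ]ₙ [ n ] ⟩
  map (incr n) [ m ]ₙ ++ [ incr n n ]        ≡⟨ cong₂ (λ xs y → xs ++ [ y ]) shifted (incr-self n) ⟩
  map suc [ m ]ₙ ++ [ 1 ]                    ↭⟨ ∷↭∷ʳ 1 (map suc [ m ]ₙ) ⟨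
  1 ∷ map suc [ m ]ₙ                         ≡⟨ []ₙ-∷ m ⟨
  [ n ]ₙ                                     ∎
  where
  open PermutationReasoning
  n = suc m
  shifted : map (incr n) [ m ]ₙ ≡ map suc [ m ]ₙ
  shifted = map-cong-local (All.map (λ x≤m → incr-≢ (<⇒≢ (s≤s x≤m))) (All-≤-[]ₙ m))

incr^-permutes : ∀ n k → map (incr n ^[ k ]) [ n ]ₙ ↭ [ n ]ₙ
incr^-permutes n zero    = ↭-reflexive (map-id [ n ]ₙ)
incr^-permutes n (suc k) = ↭-trans (↭-reflexive (map-∘ [ n ]ₙ))
  (↭-trans (Perm.map⁺ (incr n) (incr^-permutes n k)) (incr-permutes n))

secondLast-∷ʳ-∷ʳ : ∀ zs a n → secondLast ((zs ++ [ a ]) ++ [ n ]) ≡ a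
secondLast-∷ʳ-∷ʳ zs a n rewrite initL-∷ʳ (zs ++ [ a ]) n = lastOr-∷ʳ 0 zs a

τ-∷ʳ-∷ʳ : ∀ {n} zs a → All (_< n) (zs ++ [ a ]) →
          τ n ((zs ++ [ a ]) ++ [ n ]) ≡ map (incr n ^[ n ∸ a ]) (n ∷ zs ++ [ a ])
τ-∷ʳ-∷ʳ {n} zs a <n rewrite secondLast-∷ʳ-∷ʳ zs a n =
  σ^-n∸a (n ∸ a) (m+[n∸m]≡n (<⇒≤ a<n)) (m<n⇒0<n∸m a<n)
  where
  a<n : a < n
  a<n = proj₂ (∷ʳ⁻ <n)
  σ^-n∸a : ∀ k → a + k ≡ n → 0 < k →
           (σ n ^[ k ]) ((zs ++ [ a ]) ++ [ n ]) ≡ map (incr n ^[ k ]) (n ∷ zs ++ [ a ])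
  σ^-n∸a (suc t) eq _ = σ^-∷ʳ-self zs a <n t (≤-reflexive eq)

IsPermEndingIn : ℕ → List ℕ → Set
IsPermEndingIn n ζ = IsPerm n ζ × ∃₂ λ zs a → ζ ≡ (zs ++ [ a ]) ++ [ n ]

IsPerm⇒IsPermEndingIn : ∀ {n} x xs → IsPerm n ((x ∷ xs) ++ [ n ]) → IsPermEndingIn n ((x ∷ xs) ++ [ n ])
IsPerm⇒IsPermEndingIn {n} x xs perm = perm , initL (x ∷ xs) , lastOr x xs , cong (_++ [ n ]) (initL-++-lastOr x xs)

τ-rotateʳ : ∀ {n ζ} → IsPermEndingIn n ζ → ∃ λ k → τ n ζ ≡ map (incr n ^[ k ]) (rotateʳ ζ)
τ-rotateʳ {n} (perm , zs , a , refl) =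
  n ∸ a , trans (τ-∷ʳ-∷ʳ zs a (IsPerm-∷ʳ-< (zs ++ [ a ]) perm))
                (cong (map (incr n ^[ n ∸ a ])) (sym (rotateʳ-∷ʳ (zs ++ [ a ]) n)))

τ-preserves : ∀ {n ζ} → IsPermEndingIn n ζ → IsPermEndingIn n (τ n ζ)
τ-preserves {n} (perm , zs , a , refl) =
  subst (IsPermEndingIn n) (sym (τ-∷ʳ-∷ʳ zs a <n))
    (↭-trans (Perm.map⁺ g (↭-trans (∷↭∷ʳ n (zs ++ [ a ])) perm)) (incr^-permutes n (n ∸ a)) ,
     initL (g n ∷ map g zs) , lastOr (g n) (map g zs) , shape)
  where
  <n : All (_< n) (zs ++ [ a ])
  <n = IsPerm-∷ʳ-< (zs ++ [ a ]) perm
  g = incr n ^[ n ∸ a ]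
  a+[n∸a]≡n : a + (n ∸ a) ≡ n
  a+[n∸a]≡n = m+[n∸m]≡n (<⇒≤ (proj₂ (∷ʳ⁻ <n)))
  shape : map g (n ∷ zs ++ [ a ]) ≡ (initL (g n ∷ map g zs) ++ [ lastOr (g n) (map g zs) ]) ++ [ n ]
  shape = begin
    g n ∷ map g (zs ++ [ a ])  ≡⟨ cong (g n ∷_) (map-++ g zs [ a ]) ⟩
    g n ∷ map g zs ++ [ g a ]  ≡⟨ cong₂ (λ xs x → xs ++ [ x ])
                                        (initL-++-lastOr (g n) (map g zs))
                                        (trans (incr^-+ a (n ∸ a) (≤-reflexive a+[n∸a]≡n)) a+[n∸a]≡n) ⟩
    (initL (g n ∷ map g zs) ++ [ lastOr (g n) (map g zs) ]) ++ [ n ] ∎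
    where open ≡-Reasoning

τ^-preserves : ∀ {n ξ} → IsPermEndingIn n ξ → ∀ k → IsPermEndingIn n ((τ n ^[ k ]) ξ)
τ^-preserves inv zero    = inv
τ^-preserves inv (suc k) = τ-preserves (τ^-preserves inv k)

τ^-rotateʳ : ∀ {n ξ} → parity n ≡ 0ℙ → IsPermEndingIn n ξ → ∀ k →
             ∃ λ G → ShiftsParity G × (τ n ^[ k ]) ξ ≡ map G ((rotateʳ ^[ k ]) ξ)
τ^-rotateʳ {ξ = ξ} even inv zero = id , ShiftsParity-id , sym (map-id ξ)
τ^-rotateʳ {n} {ξ} even inv (suc k)
  with G , shifts , eq ← τ^-rotateʳ even inv k
     | j , eq′ ← τ-rotateʳ (τ^-preserves inv k) =
  g ∘ G , ShiftsParity-∘ (ShiftsParity-^ (shiftsBy 1ℙ (parity-incr even)) j) shifts , (begin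
    τ n ((τ n ^[ k ]) ξ)               ≡⟨ eq′ ⟩
    map g (rotateʳ ((τ n ^[ k ]) ξ))   ≡⟨ cong (map g ∘ rotateʳ) eq ⟩
    map g (rotateʳ (map G w))          ≡⟨ cong (map g) (rotateʳ-map G w) ⟩
    map g (map G (rotateʳ w))          ≡⟨ map-∘ (rotateʳ w) ⟨
    map (g ∘ G) (rotateʳ w)            ∎)
  where
  open ≡-Reasoning
  g = incr n ^[ j ]
  w = (rotateʳ ^[ k ]) ξ

τ^-drop-take : ∀ {n ξ} → parity n ≡ 0ℙ → IsPermEndingIn n ξ → ∀ i →
               ∃ λ G → ShiftsParity G × (τ n ^[ n ∸ i ]) ξ ≡ map G (drop i ξ ++ take i ξ)
τ^-drop-take {n} {ξ} even inv i with G , shifts , eq ← τ^-rotateʳ even inv (n ∸ i) =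
  G , shifts , trans eq (cong (map G) (begin
    (rotateʳ ^[ n ∸ i ]) ξ                        ≡⟨ cong (rotateʳ ^[ n ∸ i ]) (take++drop≡id i ξ) ⟨
    (rotateʳ ^[ n ∸ i ]) (take i ξ ++ drop i ξ)   ≡⟨ rotateʳ^-++ _ (take i ξ) (drop i ξ) |drop| ⟩
    drop i ξ ++ take i ξ                          ∎))
  where
  open ≡-Reasoning
  |drop| : length (drop i ξ) ≡ n ∸ i
  |drop| = trans (length-drop i ξ) (cong (_∸ i) (IsPerm-length (proj₁ inv)))

lemma2 : (n : ℕ) → 0 < n → 2 ∣ n →
         (a₁ : ℕ) (as : List ℕ) (i : ℕ) →
         IsPerm n ((a₁ ∷ as) ++ [ n ]) →
         ¬ Alternating ((a₁ ∷ as) ++ [ n ]) →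
         IsMaximalPAP ((a₁ ∷ as) ++ [ n ]) i n →
         2 ∣ a₁ →
         IsMaximalPAP ((τ n ^[ n ∸ i ]) ((a₁ ∷ as) ++ [ n ])) 0 (n ∸ i)
lemma2 n _ _ a₁ as zero perm ¬alt ((_ , _ , alt) , _) _ =
  ⊥-elim (¬alt (subst Alternating (take-all n _ (≤-reflexive (IsPerm-length perm))) alt))
lemma2 n _ 2∣n a₁ as (suc i) perm _ ((i<n , _ , alt) , _) 2∣a₁
  with G , shifts , τ^ξ≡ ← τ^-drop-take (parity-even 2∣n) (IsPerm⇒IsPermEndingIn a₁ as perm) (suc i) =
  subst (λ xs → IsMaximalPAP xs 0 (n ∸ suc i)) (sym τ^ξ≡) (IsMaximalPAP-map shifts rotatedPAP)
  where
  ξ = (a₁ ∷ as) ++ [ n ]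
  A′ = take i (as ++ [ n ])
  B = drop i as ++ [ n ]
  |ξ| : length ξ ≡ n
  |ξ| = IsPerm-length perm
  B≡ : drop (suc i) ξ ≡ B
  B≡ = drop-∷ʳ i as n (s<s⁻¹ (subst (suc i <_) (sym |ξ|) i<n))
  altB : Alternating B
  altB = subst Alternating B≡ (subst (Alternating ∘ drop (suc i)) (take-all n ξ (≤-reflexive |ξ|)) alt)
  |B| : length B ≡ n ∸ suc i
  |B| = trans (cong length (sym B≡)) (trans (length-drop (suc i) ξ) (cong (_∸ suc i) |ξ|))
  n≡a₁ : n % 2 ≡ a₁ % 2
  n≡a₁ = from (%2-≡⇔parity-≡ n a₁) (trans (parity-even 2∣n) (sym (parity-even 2∣a₁)))
  rotatedPAP : IsMaximalPAP (drop (suc i) ξ ++ take (suc i) ξ) 0 (n ∸ suc i)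
  rotatedPAP = subst₂ (λ xs t → IsMaximalPAP (xs ++ a₁ ∷ A′) 0 t) (sym B≡) |B|
                 (IsMaximalPAP-prefix (drop i as) A′ altB n≡a₁)
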